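{- Let $\mathbf P=(P,\leq,{}',0,1)$ be an orthogonal lub-complete poset. Then the following are equivalent: (i) $\mathbf P$ is an orthocomplemented poset; (ii) for all $x,y\in P$, $x\leq y$ implies $x\rightarrow_K y=\{1\}$; (iii) for all $x,y\in P$, $x\leq y$ implies $x\rightarrow_N y=\{1\}$.
   Context: For a poset $(P,\leq)$ and $A\subseteq P$: $L(A)=\{x: x\leq a\ \forall a\in A\}$, $U(A)=\{x: a\leq x\ \forall a\in A\}$, $L(x,y)=L(\{x,y\})$, $U(x,y)=U(\{x,y\})$; $\operatorname{Max}A$, $\operatorname{Min}A$: maximal/minimal elements of $A$. A bounded poset $(P,\leq,{}',0,1)$ with antitone involution: $x\leq y\Rightarrow y'\leq x'$, $x''=x$. $x\perp y$ iff $x\leq y'$. Orthogonal: $x\perp y$ implies the supremum $x\vee y$ exists. Lub-complete: for every finite $M\subseteq P$ and lower bound $x$ of $M$ there is a maximal element of $L(M)$ above $x$. Orthocomplemented: $x\vee x'=1$ for all $x$. Kalmbach implication: $x\rightarrow_K y=\{(a\vee b)\vee(x\wedge c): a\in\operatorname{Max}L(x',y), b\in\operatorname{Max}L(x',y'), c\in\operatorname{Min}U(x',y)\}$; non-tolens implication: $x\rightarrow_N y=y'\rightarrow_K x'$. -}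

module Defs where

open import Level using (Level; _⊔_; suc)
open import Data.Product using (Σ; ∃; _×_; _,_)
open import Data.List using (List; []; _∷_)
open import Data.List.Relation.Unary.All using (All)
open import Relation.Binary.Bundles using (Poset)
open import Relation.Unary using (Pred)
open import Function.Bundles using (_⇔_)

record BPAI (c ℓ₁ ℓ₂ : Level) : Set (suc (c ⊔ ℓ₁ ⊔ ℓ₂)) where
  field
    poset : Poset c ℓ₁ ℓ₂
  open Poset poset public
  field
    _′   : Carrier → Carrier
    𝟘 𝟙  : Carrier
    bot  : ∀ x → 𝟘 ≤ x
    top  : ∀ x → x ≤ 𝟙
    antitone   : ∀ {x y} → x ≤ y → y ′ ≤ x ′
    involutive : ∀ x → (x ′) ′ ≈ x
  infix 8 _′

module _ {c ℓ₁ ℓ₂ : Level} (P : BPAI c ℓ₁ ℓ₂) where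
  open BPAI P

  -- L(M) and U(M) for a finite set M given as a list
  Lset : List Carrier → Pred Carrier (c ⊔ ℓ₂)
  Lset M x = All (x ≤_) M

  Uset : List Carrier → Pred Carrier (c ⊔ ℓ₂)
  Uset M x = All (_≤ x) M

  Lxy : Carrier → Carrier → Pred Carrier (c ⊔ ℓ₂)
  Lxy x y = Lset (x ∷ y ∷ [])

  Uxy : Carrier → Carrier → Pred Carrier (c ⊔ ℓ₂)
  Uxy x y = Uset (x ∷ y ∷ [])

  Max : ∀ {ℓ} → Pred Carrier ℓ → Pred Carrier (c ⊔ ℓ ⊔ ℓ₁ ⊔ ℓ₂)
  Max A x = A x × (∀ y → A y → x ≤ y → x ≈ y)

  Min : ∀ {ℓ} → Pred Carrier ℓ → Pred Carrier (c ⊔ ℓ ⊔ ℓ₁ ⊔ ℓ₂)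
  Min A x = A x × (∀ y → A y → y ≤ x → x ≈ y)

  IsSup : Carrier → Carrier → Carrier → Set (c ⊔ ℓ₂)
  IsSup x y z = x ≤ z × y ≤ z × (∀ w → x ≤ w → y ≤ w → z ≤ w)

  IsInf : Carrier → Carrier → Carrier → Set (c ⊔ ℓ₂)
  IsInf x y z = z ≤ x × z ≤ y × (∀ w → w ≤ x → w ≤ y → w ≤ z)

  _⊥_ : Carrier → Carrier → Set ℓ₂
  x ⊥ y = x ≤ y ′

  Orthogonal : Set (c ⊔ ℓ₂)
  Orthogonal = ∀ x y → x ⊥ y → ∃ λ z → IsSup x y z

  LubComplete : Set (c ⊔ ℓ₁ ⊔ ℓ₂)
  LubComplete = ∀ (M : List Carrier) x → Lset M x →
                ∃ λ m → Max (Lset M) m × x ≤ m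

  Orthocomplemented : Set (c ⊔ ℓ₂)
  Orthocomplemented = ∀ x → IsSup x (x ′) 𝟙

  -- Kalmbach implication, as a subset of P:
  -- z ∈ x →K y iff z = (a ∨ b) ∨ (x ∧ c) for some
  -- a ∈ Max L(x′,y), b ∈ Max L(x′,y′), c ∈ Min U(x′,y)
  _→K_ : Carrier → Carrier → Pred Carrier (c ⊔ ℓ₁ ⊔ ℓ₂)
  (x →K y) z = ∃ λ a → ∃ λ b → ∃ λ c' → ∃ λ d → ∃ λ e →
      Max (Lxy (x ′) y) a × Max (Lxy (x ′) (y ′)) b × Min (Uxy (x ′) y) c'
    × IsSup a b d × IsInf x c' e × IsSup d e z

  _→N_ : Carrier → Carrier → Pred Carrier (c ⊔ ℓ₁ ⊔ ℓ₂)
  x →N y = (y ′) →K (x ′)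

  IsSingleton𝟙 : Pred Carrier (c ⊔ ℓ₁ ⊔ ℓ₂) → Set (c ⊔ ℓ₁ ⊔ ℓ₂)
  IsSingleton𝟙 S = ∀ z → S z ⇔ (z ≈ 𝟙)

  ConditionK : Set (c ⊔ ℓ₁ ⊔ ℓ₂)
  ConditionK = ∀ x y → x ≤ y → IsSingleton𝟙 (x →K y)

  ConditionN : Set (c ⊔ ℓ₁ ⊔ ℓ₂)
  ConditionN = ∀ x y → x ≤ y → IsSingleton𝟙 (x →N y)

-- In an orthocomplemented poset, take z ∈ x →K y with x ≤ y.  Then L(x′,y′) = L(y′) forces
-- b = y′, and x ≤ y ≤ c puts x below x ∧ c, so z lies above a, x and y′; hence z′ ∈ L(x′,y).
-- Since a ⊥ z′, the join a ∨ z′ exists and lies in L(x′,y), so maximality of a gives z′ ≤ a,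
-- i.e. a′ ≤ z, and z ≥ a ∨ a′ = 1.  Conversely 1 ∈ x →K y is witnessed by b = y′, c = 1 and
-- any maximal a ∈ L(x′,y), which lub-completeness provides.  For the other implications, any
-- upper bound of x and x′ lies above every element of x →K x, so 1 ∈ x →K x makes 1 = x ∨ x′;
-- and x →N y = y′ →K x′ with y′ ≤ x′.
module Submission where

open import Defs
open import Level using (Level)
open import Data.Product using (_×_; _,_; proj₂; uncurry)
open import Data.List using ([]; _∷_)
open import Data.List.Relation.Unary.All as All using ([]; _∷_)
open import Function.Bundles using (_⇔_; mk⇔; Equivalence)

module _ {c ℓ₁ ℓ₂ : Level} (P : BPAI c ℓ₁ ℓ₂) where
  open BPAI P

  ′′-≤ : ∀ x → x ′ ′ ≤ x
  ′′-≤ x = reflexive (involutive x)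

  ≤-′′ : ∀ x → x ≤ x ′ ′
  ≤-′′ x = reflexive (Eq.sym (involutive x))

  IsSup-resp-≈ : ∀ {x y z w} → z ≈ w → IsSup P x y z → IsSup P x y w
  IsSup-resp-≈ z≈w (x≤z , y≤z , least) =
    trans x≤z (reflexive z≈w) , trans y≤z (reflexive z≈w) ,
    λ u x≤u y≤u → trans (reflexive (Eq.sym z≈w)) (least u x≤u y≤u)

  IsSup-respˡ-≈ : ∀ {x x̃ y z} → x ≈ x̃ → IsSup P x y z → IsSup P x̃ y z
  IsSup-respˡ-≈ x≈x̃ (x≤z , y≤z , least) =
    trans (reflexive (Eq.sym x≈x̃)) x≤z , y≤z ,
    λ u x̃≤u y≤u → least u (trans (reflexive x≈x̃) x̃≤u) y≤u

  IsSup-comm : ∀ {x y z} → IsSup P x y z → IsSup P y x z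
  IsSup-comm (x≤z , y≤z , least) = y≤z , x≤z , λ u y≤u x≤u → least u x≤u y≤u

  IsSup-Lset : ∀ {M x y z} → IsSup P x y z → Lset P M x → Lset P M y → Lset P M z
  IsSup-Lset (_ , _ , least) Mx My = All.zipWith (uncurry (least _)) (Mx , My)

  ≤-Max-Lxy : ∀ {x y} → y ≤ x → Max P (Lxy P x y) y
  ≤-Max-Lxy y≤x = (y≤x ∷ refl ∷ []) , λ { w (_ ∷ w≤y ∷ []) y≤w → antisym y≤w w≤y }

  Max-Lxy-≈ : ∀ {x y b} → y ≤ x → Max P (Lxy P x y) b → b ≈ y
  Max-Lxy-≈ y≤x ((_ ∷ b≤y ∷ []) , maximal) = maximal _ (y≤x ∷ refl ∷ []) b≤y

  →K-resp-≈ : ∀ {x y z w} → z ≈ w → _→K_ P x y z → _→K_ P x y w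
  →K-resp-≈ z≈w (a , b , c′ , d , e , aM , bM , cM , d-sup , e-inf , z-sup) =
    a , b , c′ , d , e , aM , bM , cM , d-sup , e-inf , IsSup-resp-≈ z≈w z-sup

  𝟙∈→K-self⇒complemented : ∀ {x} → _→K_ P x x 𝟙 → IsSup P x (x ′) 𝟙
  𝟙∈→K-self⇒complemented
    (a , b , c′ , d , e , ((a≤x′ ∷ _) , _) , ((b≤x′ ∷ _) , _) , _ ,
     (_ , _ , d-least) , (e≤x , _) , (_ , _ , 𝟙-least)) =
    top _ , top _ ,
    λ u x≤u x′≤u → 𝟙-least u (d-least u (trans a≤x′ x′≤u) (trans b≤x′ x′≤u)) (trans e≤x x≤u)

  Orthocomplemented⇒Min-Uxy-𝟙 : Orthocomplemented P → ∀ {x y} → x ≤ y → Min P (Uxy P (x ′) y) 𝟙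
  Orthocomplemented⇒Min-Uxy-𝟙 oc {x} x≤y =
    (top _ ∷ top _ ∷ []) ,
    λ { w (x′≤w ∷ y≤w ∷ []) w≤𝟙 → antisym (proj₂ (proj₂ (oc x)) w (trans x≤y y≤w) x′≤w) w≤𝟙 }

  module _ (orth : Orthogonal P) where

    Max-Lset-absorbs-⊥ : ∀ {M a w} → Max P (Lset P M) a → Lset P M w → _⊥_ P a w → w ≤ a
    Max-Lset-absorbs-⊥ (Ma , maximal) Mw a⊥w with orth _ _ a⊥w
    ... | s , s-sup@(a≤s , w≤s , _) =
      trans w≤s (reflexive (Eq.sym (maximal s (IsSup-Lset s-sup Ma Mw) a≤s)))

    module _ (oc : Orthocomplemented P) where

      →K-≈𝟙 : ∀ {x y z} → x ≤ y → _→K_ P x y z → z ≈ 𝟙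
      →K-≈𝟙 {x} {y} {z} x≤y
        (a , b , c′ , d , e , aM , bM , ((_ ∷ y≤c′ ∷ []) , _) ,
         (a≤d , b≤d , _) , (_ , _ , e-greatest) , (d≤z , e≤z , _)) =
        antisym (top z) (proj₂ (proj₂ (oc a)) z a≤z a′≤z)
        where
          a≤z : a ≤ z
          a≤z = trans a≤d d≤z
          x≤z : x ≤ z
          x≤z = trans (e-greatest x refl (trans x≤y y≤c′)) e≤z
          y′≤z : y ′ ≤ z
          y′≤z = trans (reflexive (Eq.sym (Max-Lxy-≈ (antitone x≤y) bM))) (trans b≤d d≤z)
          z′≤a : z ′ ≤ a
          z′≤a = Max-Lset-absorbs-⊥ aM (antitone x≤z ∷ trans (antitone y′≤z) (′′-≤ y) ∷ [])
                   (trans a≤z (≤-′′ z))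
          a′≤z : a ′ ≤ z
          a′≤z = trans (antitone z′≤a) (′′-≤ z)

      𝟙∈→K : LubComplete P → ∀ {x y} → x ≤ y → _→K_ P x y 𝟙
      𝟙∈→K lub {x} {y} x≤y with lub (x ′ ∷ y ∷ []) 𝟘 (bot _ ∷ bot _ ∷ [])
      ... | a , aM@((a≤x′ ∷ a≤y ∷ []) , _) , _ with orth a (y ′) (trans a≤y (≤-′′ y))
      ... | d , d-sup@(_ , _ , d-least) with orth d x (d-least (x ′) a≤x′ (antitone x≤y))
      ... | z , z-sup = →K-resp-≈ (→K-≈𝟙 x≤y z∈x→Ky) z∈x→Ky
        where
          x-inf : IsInf P x 𝟙 x
          x-inf = refl , top x , λ w w≤x _ → w≤x
          z∈x→Ky : _→K_ P x y z
          z∈x→Ky = a , y ′ , 𝟙 , d , x , aM , ≤-Max-Lxy (antitone x≤y) ,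
                   Orthocomplemented⇒Min-Uxy-𝟙 oc x≤y , d-sup , x-inf , z-sup

  orthocomplemented⇒conditionK : Orthogonal P → LubComplete P → Orthocomplemented P → ConditionK P
  orthocomplemented⇒conditionK orth lub oc x y x≤y z =
    mk⇔ (→K-≈𝟙 orth oc x≤y) (λ z≈𝟙 → →K-resp-≈ (Eq.sym z≈𝟙) (𝟙∈→K orth oc lub x≤y))

  conditionK⇒orthocomplemented : ConditionK P → Orthocomplemented P
  conditionK⇒orthocomplemented K x = 𝟙∈→K-self⇒complemented (Equivalence.from (K x x refl 𝟙) Eq.refl)

  conditionK⇒conditionN : ConditionK P → ConditionN P
  conditionK⇒conditionN K x y x≤y = K (y ′) (x ′) (antitone x≤y)

  conditionN⇒orthocomplemented : ConditionN P → Orthocomplemented P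
  conditionN⇒orthocomplemented N x =
    IsSup-respˡ-≈ (involutive x)
      (IsSup-comm (𝟙∈→K-self⇒complemented (Equivalence.from (N x x refl 𝟙) Eq.refl)))

theorem4 : ∀ {c ℓ₁ ℓ₂ : Level} (P : BPAI c ℓ₁ ℓ₂) →
    Orthogonal P → LubComplete P →
    (Orthocomplemented P ⇔ ConditionK P) × (Orthocomplemented P ⇔ ConditionN P)
theorem4 P orth lub =
  mk⇔ (orthocomplemented⇒conditionK P orth lub) (conditionK⇒orthocomplemented P) ,
  mk⇔ (λ oc → conditionK⇒conditionN P (orthocomplemented⇒conditionK P orth lub oc))
      (conditionN⇒orthocomplemented P)
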